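{- Let $H$ be a finite simple graph with minimum degree $\delta(H)>|V(H)|/2$. Then for every finite simple graph $G$, $$\kappa'(G\times H)=\min\{2\kappa'(G)\,e(H),\ \delta(G)\delta(H)\},$$ where $e(H)$ is the number of edges of $H$.
   Context: All graphs are finite, undirected, without loops or multiple edges. $\kappa'(X)$ denotes the edge connectivity of a graph $X$ (the minimum number of edges whose removal disconnects $X$), and $\delta(X)$ its minimum degree. The direct product $G\times H$ has vertex set $V(G)\times V(H)$, with $(x,u)$ adjacent to $(y,v)$ if and only if $xy\in E(G)$ and $uv\in E(H)$. -}

module Defs where

open import Data.Nat using (ℕ; zero; suc; _+_; _*_; _≤_; _<ᵇ_; _⊓_)
open import Data.Bool using (Bool; true; false; _∧_; not; if_then_else_; T)
open import Data.Fin using (Fin; toℕ; remQuot)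
open import Data.List using (List; map; foldr; allFin)
open import Data.Nat.ListAction using (sum)
open import Data.Product using (Σ; _×_; _,_; proj₁; proj₂)
open import Data.Sum using (_⊎_)
open import Relation.Binary.PropositionalEquality using (_≡_; refl; cong₂)
open import Relation.Binary.Construct.Closure.ReflexiveTransitive using (Star)
open import Relation.Nullary using (¬_)

record Graph : Set where
  field
    n      : ℕ
    adj    : Fin n → Fin n → Bool
    sym    : ∀ x y → adj x y ≡ adj y x
    irrefl : ∀ x → adj x x ≡ false
open Graph public

b2n : Bool → ℕ
b2n true  = 1
b2n false = 0

deg : (G : Graph) → Fin (n G) → ℕ
deg G x = sum (map (λ y → b2n (adj G x y)) (allFin (n G)))

-- minimum degree δ(G) (convention: 0 for the graph with no vertices)
minDegAux : (m : ℕ) → (Fin m → ℕ) → ℕ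
minDegAux zero    d = 0
minDegAux (suc m) d = foldr _⊓_ (d Fin.zero) (map d (allFin (suc m)))
  where import Data.Fin as Fin

δ : Graph → ℕ
δ G = minDegAux (n G) (deg G)

pairCount : (m : ℕ) → (Fin m → Fin m → Bool) → ℕ
pairCount m r =
  sum (map (λ x → sum (map (λ y → b2n ((toℕ x <ᵇ toℕ y) ∧ r x y)) (allFin m))) (allFin m))

e : Graph → ℕ
e G = pairCount (n G) (adj G)

record EdgeSet (G : Graph) : Set where
  field
    rem    : Fin (n G) → Fin (n G) → Bool
    remSym : ∀ x y → rem x y ≡ rem y x
    rem⊆   : ∀ x y → rem x y ≡ true → adj G x y ≡ true
open EdgeSet public

size : {G : Graph} → EdgeSet G → ℕ
size {G} F = pairCount (n G) (rem F)

adjMinus : (G : Graph) → EdgeSet G → Fin (n G) → Fin (n G) → Bool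
adjMinus G F x y = adj G x y ∧ not (rem F x y)

Disconnects : (G : Graph) → EdgeSet G → Set
Disconnects G F =
  Σ (Fin (n G)) λ x → Σ (Fin (n G)) λ y →
    ¬ Star (λ a b → T (adjMinus G F a b)) x y

-- κ'(G) = k : minimum size of an edge set whose removal disconnects G;
-- by convention κ' = 0 for graphs with at most one vertex.
IsEdgeConn : Graph → ℕ → Set
IsEdgeConn G k =
  (n G ≤ 1 × k ≡ 0)
  ⊎ (2 ≤ n G
     × Σ (EdgeSet G) (λ F → Disconnects G F × size F ≡ k)
     × (∀ (F : EdgeSet G) → Disconnects G F → k ≤ size F))

-- direct product G × H on vertex set Fin (n G * n H) ≅ Fin (n G) × Fin (n H)
-- (via Data.Fin.remQuot / combine)
pr : (G H : Graph) → Fin (n G * n H) → Fin (n G) × Fin (n H)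
pr G H i = remQuot {n G} (n H) i

prodAdj : (G H : Graph) → Fin (n G * n H) → Fin (n G * n H) → Bool
prodAdj G H i j =
  adj G (proj₁ (pr G H i)) (proj₁ (pr G H j))
  ∧ adj H (proj₂ (pr G H i)) (proj₂ (pr G H j))

prodSym : (G H : Graph) → ∀ i j → prodAdj G H i j ≡ prodAdj G H j i
prodSym G H i j =
  cong₂ _∧_ (sym G (proj₁ (pr G H i)) (proj₁ (pr G H j)))
            (sym H (proj₂ (pr G H i)) (proj₂ (pr G H j)))

prodIrrefl : (G H : Graph) → ∀ i → prodAdj G H i i ≡ false
prodIrrefl G H i rewrite irrefl G (proj₁ (pr G H i)) = refl

_×ᵍ_ : Graph → Graph → Graph
G ×ᵍ H = record
  { n = n G * n H
  ; adj = prodAdj G H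
  ; sym = prodSym G H
  ; irrefl = prodIrrefl G H
  }

module Submission where

-- Edge connectivity is the least size of a boundary ∂S of a proper nonempty
-- vertex set S: a disconnecting edge set contains the boundary of a component
-- (found by breadth-first search), and every such boundary disconnects.  For
-- S ⊆ V(G × H) with fibres S_x ⊆ V(H), counting ordered pairs gives
-- 2|∂S| = Σ_{xy ∈ E(G)} c(S_x, S_y), where c(A, B) counts ordered edges uv of H
-- with [u ∈ A] ≠ [v ∈ B].  If all fibres are empty or full, S = X × V(H) and
-- |∂S| = |∂X| · 2e(H) ≥ 2κ'(G)e(H).  If some fibre S_x is proper, density of H
-- gives c(S_x, B) ≥ δ(H) for all B, so the row and column of x contribute
-- 2 deg(x) δ(H) ≥ 2δ(G)δ(H).  Both values are attained, by X × V(H) for a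
-- minimum boundary X of G and by a vertex (x, u) of degree δ(G)δ(H).

open import Defs
open import Data.Nat using (ℕ; zero; suc; _+_; _*_; _∸_; _≤_; _<_; z≤n; s≤s; _<ᵇ_; _⊓_; _≤?_; _<?_)
open import Data.Nat.Properties
open import Data.Nat.ListAction using (sum)
open import Data.Nat.Tactic.RingSolver using (solve-∀)
open import Data.Bool using (Bool; true; false; _∧_; _∨_; not; _xor_; T)
open import Data.Bool.Properties
  using (∧-assoc; ∧-zeroʳ; ∧-identityʳ; T-∧; T-∨; T-≡; T?; xor-comm; not-involutive)
import Data.Bool as Bool
open import Data.Fin using (Fin; zero; suc; toℕ; combine; _↑ˡ_; _↑ʳ_; punchIn)
open import Data.Fin.Properties using (toℕ-injective; any?; remQuot-combine; combine-remQuot)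
import Data.Fin as Fin
import Data.List as List
open import Data.List.Membership.Propositional using (_∈_)
open import Data.List.Membership.Propositional.Properties using (∈-map⁺; ∈-map⁻; ∈-allFin; foldr-selective)
open import Data.List.Relation.Unary.Any using (here; there)
open import Data.Product using (Σ; _×_; _,_; proj₁; proj₂)
open import Data.Sum using (_⊎_; inj₁; inj₂)
open import Data.Unit using (tt)
open import Function using (_∘_)
open import Function.Bundles using (Equivalence)
open import Relation.Nullary using (¬_; yes; no; does; contradiction)
open import Relation.Nullary.Decidable
  using (⌊_⌋; dec-true; toWitness; fromWitness; decidable-stable; _×-dec_; ¬?)
open import Relation.Binary.Construct.Closure.ReflexiveTransitive using (Star; ε; _◅_; _◅◅_)
open import Relation.Binary.PropositionalEquality renaming (sym to ≡-sym)
open import Algebra.Properties.CommutativeSemigroup +-commutativeSemigroup using (interchange)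
open import Algebra.Properties.Semiring.Sum +-*-semiring
  using (sum-syntax; sum-cong-≗; ∑-distrib-+; ∑-comm; *-distribˡ-sum; *-distribʳ-sum; sum-replicate-zero; sum-remove)

open Equivalence using (to; from)

∑-mono-≤ : ∀ {m} {f g : Fin m → ℕ} → (∀ i → f i ≤ g i) → ∑[ i < m ] f i ≤ ∑[ i < m ] g i
∑-mono-≤ {zero}  f≤g = z≤n
∑-mono-≤ {suc m} f≤g = +-mono-≤ (f≤g zero) (∑-mono-≤ (f≤g ∘ suc))

∑-mono-< : ∀ {m} {f g : Fin m → ℕ} → (∀ i → f i ≤ g i) →
           ∀ p → f p < g p → ∑[ i < m ] f i < ∑[ i < m ] g i
∑-mono-< f≤g zero    fp<gp = +-mono-<-≤ fp<gp (∑-mono-≤ (f≤g ∘ suc))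
∑-mono-< f≤g (suc p) fp<gp = +-mono-≤-< (f≤g zero) (∑-mono-< (f≤g ∘ suc) p fp<gp)

term≤∑ : ∀ {m} (f : Fin m → ℕ) p → f p ≤ ∑[ i < m ] f i
term≤∑ f zero    = m≤m+n _ _
term≤∑ f (suc p) = ≤-trans (term≤∑ (f ∘ suc) p) (m≤n+m _ _)

∑-const : ∀ m c → ∑[ i < m ] c ≡ m * c
∑-const zero    c = refl
∑-const (suc m) c = cong (c +_) (∑-const m c)

∑-↑ : ∀ a b (f : Fin (a + b) → ℕ) →
      ∑[ i < a + b ] f i ≡ ∑[ i < a ] f (i ↑ˡ b) + ∑[ j < b ] f (a ↑ʳ j)
∑-↑ zero    b f = refl
∑-↑ (suc a) b f = trans (cong (f zero +_) (∑-↑ a b (f ∘ suc))) (≡-sym (+-assoc (f zero) _ _))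

∑-combine : ∀ a b (f : Fin (a * b) → ℕ) →
            ∑[ i < a * b ] f i ≡ ∑[ x < a ] ∑[ u < b ] f (combine x u)
∑-combine zero    b f = refl
∑-combine (suc a) b f =
  trans (∑-↑ b (a * b) f) (cong (∑[ u < b ] f (u ↑ˡ (a * b)) +_) (∑-combine a b (f ∘ (b ↑ʳ_))))

∑-indicator : ∀ {m} (p : Fin m) (f : Fin m → ℕ) → ∑[ u < m ] (b2n (does (u Fin.≟ p)) * f u) ≡ f p
∑-indicator {suc m} zero    f =
  trans (cong₂ _+_ (*-identityˡ (f zero)) (sum-replicate-zero m)) (+-identityʳ (f zero))
∑-indicator {suc m} (suc p) f = ∑-indicator p (f ∘ suc)

row+column≤∑∑ : ∀ {m} (g : Fin m → Fin m → ℕ) p → g p p ≡ 0 →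
                ∑[ z < m ] g p z + ∑[ y < m ] g y p ≤ ∑[ y < m ] ∑[ z < m ] g y z
row+column≤∑∑ {suc m} g p gpp≡0 = begin
  ∑[ z < suc m ] g p z + ∑[ y < suc m ] g y p
    ≡⟨ cong (∑[ z < suc m ] g p z +_)
            (trans (sum-remove {i = p} column) (cong (_+ ∑[ j < m ] column (punchIn p j)) gpp≡0)) ⟩
  ∑[ z < suc m ] g p z + ∑[ j < m ] column (punchIn p j)
    ≤⟨ +-monoʳ-≤ (∑[ z < suc m ] g p z) (∑-mono-≤ (λ j → term≤∑ (g (punchIn p j)) p)) ⟩
  ∑[ z < suc m ] g p z + ∑[ j < m ] row (punchIn p j)
    ≡⟨ sum-remove {i = p} row ⟨
  ∑[ y < suc m ] ∑[ z < suc m ] g y z ∎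
  where
  open ≤-Reasoning
  row column : Fin (suc m) → ℕ
  row    y = ∑[ z < suc m ] g y z
  column y = g y p

sum-map-tabulate : ∀ {A : Set} {m} (f : A → ℕ) (g : Fin m → A) →
                   sum (List.map f (List.tabulate g)) ≡ ∑[ i < m ] f (g i)
sum-map-tabulate {m = zero}  f g = refl
sum-map-tabulate {m = suc m} f g = cong (f (g zero) +_) (sum-map-tabulate f (g ∘ suc))

b2n-∧ : ∀ a b → b2n (a ∧ b) ≡ b2n a * b2n b
b2n-∧ true  b = ≡-sym (+-identityʳ (b2n b))
b2n-∧ false b = refl

b2n-mono : ∀ {a b} → (T a → T b) → b2n a ≤ b2n b
b2n-mono {false}         a⇒b = z≤n
b2n-mono {true}  {true}  a⇒b = ≤-refl
b2n-mono {true}  {false} a⇒b = contradiction (a⇒b tt) λ ()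

¬T⇒T-not : ∀ {c} → ¬ T c → T (not c)
¬T⇒T-not {false} _  = tt
¬T⇒T-not {true}  ¬c = ¬c tt

xor-cases : ∀ p q → T (p xor q) → (T p × ¬ T q) ⊎ (¬ T p × T q)
xor-cases true  false _ = inj₁ (tt , λ ())
xor-cases false true  _ = inj₂ ((λ ()) , tt)

count : ∀ {m} → (Fin m → Bool) → ℕ
count {m} s = ∑[ i < m ] b2n (s i)

-- A vertex set has at most m elements; this bounds the search rounds.
count≤ : ∀ {m} (s : Fin m → Bool) → count s ≤ m
count≤ {m} s = ≤-trans (∑-mono-≤ (λ i → bound (s i))) (≤-reflexive (trans (∑-const m 1) (*-identityʳ m)))
  where
  bound : ∀ a → b2n a ≤ 1
  bound true  = ≤-refl
  bound false = z≤n

count-compl : ∀ {m} (s : Fin m → Bool) → count s + count (not ∘ s) ≡ m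
count-compl {m} s = begin
  count s + count (not ∘ s)                 ≡⟨ ∑-distrib-+ (b2n ∘ s) (b2n ∘ not ∘ s) ⟨
  ∑[ i < m ] (b2n (s i) + b2n (not (s i)))  ≡⟨ sum-cong-≗ (λ i → one (s i)) ⟩
  ∑[ i < m ] 1                              ≡⟨ trans (∑-const m 1) (*-identityʳ m) ⟩
  m                                         ∎
  where
  open ≡-Reasoning
  one : ∀ a → b2n a + b2n (not a) ≡ 1
  one true  = refl
  one false = refl

count-pos : ∀ {m} (s : Fin m → Bool) a → T (s a) → 1 ≤ count s
count-pos s a sa = ≤-trans (b2n-mono {true} (λ _ → sa)) (term≤∑ (b2n ∘ s) a)

arcs : ∀ m → (Fin m → Fin m → Bool) → ℕ
arcs m r = ∑[ i < m ] ∑[ j < m ] b2n (r i j)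

_<ᶠ_ : ∀ {m} → Fin m → Fin m → Bool
i <ᶠ j = toℕ i <ᵇ toℕ j

<ᶠ-exclusive : ∀ {m} (i j : Fin m) → i ≢ j → b2n (i <ᶠ j) + b2n (j <ᶠ i) ≡ 1
<ᶠ-exclusive i j i≢j with i <ᶠ j in i<j | j <ᶠ i in j<i
... | true  | false = refl
... | false | true  = refl
... | true  | true  = contradiction (<ᵇ⇒< (toℕ j) (toℕ i) (subst T (≡-sym j<i) tt))
                        (<-asym (<ᵇ⇒< (toℕ i) (toℕ j) (subst T (≡-sym i<j) tt)))
... | false | false = contradiction (toℕ-injective (≤-antisym (≮⇒≥ (λ j<ⁿi → subst T j<i (<⇒<ᵇ j<ⁿi)))
                                                          (≮⇒≥ (λ i<ⁿj → subst T i<j (<⇒<ᵇ i<ⁿj))))) i≢j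

pairCount≡∑ : ∀ m (r : Fin m → Fin m → Bool) →
              pairCount m r ≡ ∑[ i < m ] ∑[ j < m ] b2n (i <ᶠ j ∧ r i j)
pairCount≡∑ m r = trans (sum-map-tabulate row (λ i → i)) (sum-cong-≗ (λ i → sum-map-tabulate (entry i) (λ j → j)))
  where
  entry : Fin m → Fin m → ℕ
  entry i j = b2n (i <ᶠ j ∧ r i j)
  row : Fin m → ℕ
  row i = sum (List.map (entry i) (List.allFin m))

arc-split : ∀ {m} (r : Fin m → Fin m → Bool) → (∀ i → r i i ≡ false) →
            ∀ i j → b2n (r i j) ≡ b2n (i <ᶠ j ∧ r i j) + b2n (j <ᶠ i ∧ r i j)
arc-split r irr i j with i Fin.≟ j
... | yes refl rewrite irr i | ∧-zeroʳ (i <ᶠ i) = refl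
... | no i≢j = begin
  b2n (r i j)                                             ≡⟨ *-identityˡ (b2n (r i j)) ⟨
  1 * b2n (r i j)                                         ≡⟨ cong (_* b2n (r i j)) (<ᶠ-exclusive i j i≢j) ⟨
  (b2n (i <ᶠ j) + b2n (j <ᶠ i)) * b2n (r i j)             ≡⟨ *-distribʳ-+ (b2n (r i j)) (b2n (i <ᶠ j)) _ ⟩
  b2n (i <ᶠ j) * b2n (r i j) + b2n (j <ᶠ i) * b2n (r i j)
    ≡⟨ cong₂ _+_ (b2n-∧ (i <ᶠ j) (r i j)) (b2n-∧ (j <ᶠ i) (r i j)) ⟨
  b2n (i <ᶠ j ∧ r i j) + b2n (j <ᶠ i ∧ r i j)             ∎
  where open ≡-Reasoning

arcs≡2*pairCount : ∀ m (r : Fin m → Fin m → Bool) → (∀ i j → r i j ≡ r j i) → (∀ i → r i i ≡ false) →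
                   arcs m r ≡ 2 * pairCount m r
arcs≡2*pairCount m r r-sym r-irr = begin
  arcs m r
    ≡⟨ sum-cong-≗ (λ i → trans (sum-cong-≗ (arc-split r r-irr i)) (∑-distrib-+ (forward i) (backward i))) ⟩
  ∑[ i < m ] (∑[ j < m ] forward i j + ∑[ j < m ] backward i j)
    ≡⟨ ∑-distrib-+ (λ i → ∑[ j < m ] forward i j) (λ i → ∑[ j < m ] backward i j) ⟩
  N + ∑[ i < m ] ∑[ j < m ] backward i j
    ≡⟨ cong (N +_) (∑-comm backward) ⟩
  N + ∑[ j < m ] ∑[ i < m ] backward i j
    ≡⟨ cong (N +_) (sum-cong-≗ (λ j → sum-cong-≗ (λ i → cong (λ b → b2n (j <ᶠ i ∧ b)) (r-sym i j)))) ⟩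
  N + N
    ≡⟨ cong (N +_) (+-identityʳ N) ⟨
  2 * N
    ≡⟨ cong (2 *_) (pairCount≡∑ m r) ⟨
  2 * pairCount m r ∎
  where
  open ≡-Reasoning
  forward backward : Fin m → Fin m → ℕ
  forward  i j = b2n (i <ᶠ j ∧ r i j)
  backward i j = b2n (j <ᶠ i ∧ r i j)
  N = ∑[ i < m ] ∑[ j < m ] forward i j

pairCount-mono : ∀ m (r r′ : Fin m → Fin m → Bool) → (∀ i j → T (r i j) → T (r′ i j)) →
                 pairCount m r ≤ pairCount m r′
pairCount-mono m r r′ r⊆r′ = subst₂ _≤_ (≡-sym (pairCount≡∑ m r)) (≡-sym (pairCount≡∑ m r′))
  (∑-mono-≤ (λ i → ∑-mono-≤ (λ j → b2n-mono (restrict (i <ᶠ j) (r⊆r′ i j)))))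
  where
  restrict : ∀ c {b b′} → (T b → T b′) → T (c ∧ b) → T (c ∧ b′)
  restrict true b⇒b′ = b⇒b′

deg≡∑ : ∀ G x → deg G x ≡ ∑[ y < n G ] b2n (adj G x y)
deg≡∑ G x = sum-map-tabulate (λ y → b2n (adj G x y)) (λ y → y)

foldr-⊓-≤ : ∀ z {d ds} → d ∈ ds → List.foldr _⊓_ z ds ≤ d
foldr-⊓-≤ z (here refl)  = m⊓n≤m _ _
foldr-⊓-≤ z (there d∈ds) = ≤-trans (m⊓n≤n _ _) (foldr-⊓-≤ z d∈ds)

minDegAux≤ : ∀ m (d : Fin m → ℕ) x → minDegAux m d ≤ d x
minDegAux≤ (suc m) d x = foldr-⊓-≤ (d zero) (∈-map⁺ d (∈-allFin x))

minDegAux-attained : ∀ m (d : Fin m → ℕ) → 1 ≤ m → Σ (Fin m) λ x → d x ≡ minDegAux m d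
minDegAux-attained (suc m) d _ with foldr-selective ⊓-sel (d zero) (List.map d (List.allFin (suc m)))
... | inj₁ min≡d0 = zero , ≡-sym min≡d0
... | inj₂ min∈ds with ∈-map⁻ d min∈ds
...   | x , _ , min≡dx = x , ≡-sym min≡dx

δ≤deg : ∀ G x → δ G ≤ deg G x
δ≤deg G = minDegAux≤ (n G) (deg G)

δ-attained : ∀ G → 1 ≤ n G → Σ (Fin (n G)) λ x → deg G x ≡ δ G
δ-attained G = minDegAux-attained (n G) (deg G)

dense-nonempty : ∀ H → n H < 2 * δ H → 1 ≤ n H
dense-nonempty H = nonempty (n H) (deg H)
  where
  nonempty : ∀ m (d : Fin m → ℕ) → m < 2 * minDegAux m d → 1 ≤ m
  nonempty (suc m) d _ = s≤s z≤n

-- Reachability in a finite directed graph, computed by breadth-first search: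
-- ball x t holds the vertices within t steps of x.  The balls grow until they
-- are closed under steps, which happens within m rounds because a ball that
-- keeps growing would exceed m elements.

module Reachability {m : ℕ} (R : Fin m → Fin m → Bool) where

  Walk : Fin m → Fin m → Set
  Walk = Star (λ a b → T (R a b))

  Closed : (Fin m → Bool) → Set
  Closed s = ∀ {a b} → T (s a) → T (R a b) → T (s b)

  expand : (Fin m → Bool) → Fin m → Bool
  expand s b = s b ∨ ⌊ any? (λ a → T? (s a ∧ R a b)) ⌋

  expand-⊇ : ∀ s {b} → T (s b) → T (expand s b)
  expand-⊇ s sb = from T-∨ (inj₁ sb)

  expand-step : ∀ s {a b} → T (s a) → T (R a b) → T (expand s b)
  expand-step s {a} {b} sa rab =
    from T-∨ (inj₂ (fromWitness {a? = any? (λ c → T? (s c ∧ R c b))} (a , from T-∧ (sa , rab))))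

  expand-cases : ∀ s {b} → T (expand s b) → T (s b) ⊎ Σ (Fin m) (λ a → T (s a) × T (R a b))
  expand-cases s e with to T-∨ e
  ... | inj₁ sb = inj₁ sb
  ... | inj₂ w with toWitness w
  ...   | a , sa∧rab = inj₂ (a , to T-∧ sa∧rab)

  expand-closed : ∀ s → Closed s → Closed (expand s)
  expand-closed s closed ea rab with expand-cases s ea
  ... | inj₁ sa             = expand-⊇ s (closed sa rab)
  ... | inj₂ (c , sc , rca) = expand-⊇ s (closed (closed sc rca) rab)

  closed-or-leaving : ∀ s → Closed s ⊎ Σ (Fin m) λ a → Σ (Fin m) λ b → T (s a) × T (R a b) × ¬ T (s b)
  closed-or-leaving s with any? (λ a → any? (λ b → T? (s a) ×-dec T? (R a b) ×-dec ¬? (T? (s b))))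
  ... | yes (a , b , leaves) = inj₂ (a , b , leaves)
  ... | no none = inj₁ λ {a} {b} sa rab → decidable-stable (T? (s b)) (λ ¬sb → none (a , b , sa , rab , ¬sb))

  expand-grows : ∀ s {a b} → T (s a) → T (R a b) → ¬ T (s b) → count s < count (expand s)
  expand-grows s {b = b} sa rab ¬sb = ∑-mono-< (λ c → b2n-mono (expand-⊇ s)) b (new ¬sb (expand-step s sa rab))
    where
    new : ∀ {c d} → ¬ T c → T d → b2n c < b2n d
    new {false} {true} _  _ = s≤s z≤n
    new {true}         ¬c _ = contradiction tt ¬c

  ball : Fin m → ℕ → Fin m → Bool
  ball x zero    b = does (b Fin.≟ x)
  ball x (suc t) = expand (ball x t)

  ball-centre : ∀ x t → T (ball x t x)
  ball-centre x zero    = from T-≡ (dec-true (x Fin.≟ x) refl)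
  ball-centre x (suc t) = expand-⊇ (ball x t) (ball-centre x t)

  ball-walk : ∀ x t {b} → T (ball x t b) → Walk x b
  ball-walk x zero {b} near with b Fin.≟ x
  ... | yes refl = ε
  ball-walk x (suc t) near with expand-cases (ball x t) near
  ... | inj₁ near′              = ball-walk x t near′
  ... | inj₂ (a , near-a , rab) = ball-walk x t near-a ◅◅ (rab ◅ ε)

  ball-closed-or-large : ∀ x t → Closed (ball x t) ⊎ t < count (ball x t)
  ball-closed-or-large x zero = inj₂ (count-pos (ball x zero) x (ball-centre x zero))
  ball-closed-or-large x (suc t) with ball-closed-or-large x t | closed-or-leaving (ball x t)
  ... | inj₁ closed | _           = inj₁ (expand-closed (ball x t) closed)
  ... | inj₂ _      | inj₁ closed = inj₁ (expand-closed (ball x t) closed)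
  ... | inj₂ large  | inj₂ (a , b , sa , rab , ¬sb) =
    inj₂ (≤-trans (s≤s large) (expand-grows (ball x t) sa rab ¬sb))

  reach : Fin m → Fin m → Bool
  reach x = ball x m

  reach-closed : ∀ x → Closed (reach x)
  reach-closed x with ball-closed-or-large x m
  ... | inj₁ closed = closed
  ... | inj₂ large  = contradiction (count≤ (reach x)) (<⇒≱ large)

  reach-centre : ∀ x → T (reach x x)
  reach-centre x = ball-centre x m

  reach-walk : ∀ x {b} → T (reach x b) → Walk x b
  reach-walk x = ball-walk x m

Proper : ∀ {m} → (Fin m → Bool) → Set
Proper {m} s = Σ (Fin m) (λ a → T (s a)) × Σ (Fin m) (λ b → ¬ T (s b))

values-differ : ∀ {m} (A : Fin m → Bool) u w → A u ≢ A w → Proper A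
values-differ A u w Au≢Aw with A u in Au | A w in Aw
... | true  | false = (u , subst T (≡-sym Au) tt) , (w , subst T Aw)
... | false | true  = (w , subst T (≡-sym Aw) tt) , (u , subst T Au)
... | true  | true  = contradiction refl Au≢Aw
... | false | false = contradiction refl Au≢Aw

singleton : ∀ {m} → Fin m → Fin m → Bool
singleton p u = does (u Fin.≟ p)

singleton-proper : ∀ {m} → 2 ≤ m → (p : Fin m) → Proper (singleton p)
singleton-proper {suc (suc m)} _ p = (p , from T-≡ (dec-true (p Fin.≟ p) refl)) , another p
  where
  another : ∀ p → Σ (Fin (suc (suc m))) λ q → ¬ T (singleton p q)
  another zero    = suc zero , λ ()
  another (suc p) = zero , λ ()
singleton-proper {suc zero} (s≤s ()) p

∂ : (Γ : Graph) → (Fin (n Γ) → Bool) → EdgeSet Γ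
∂ Γ s = record
  { rem    = λ a b → adj Γ a b ∧ (s a xor s b)
  ; remSym = λ a b → cong₂ _∧_ (Graph.sym Γ a b) (xor-comm (s a) (s b))
  ; rem⊆   = λ a b cut → to T-≡ (proj₁ (to T-∧ (from T-≡ cut)))
  }

-- walks avoiding ∂s never leave s
∂-disconnects : ∀ Γ s → Proper s → Disconnects Γ (∂ Γ s)
∂-disconnects Γ s ((a , sa) , (b , ¬sb)) = a , b , λ walk → ¬sb (stays walk sa)
  where
  step : ∀ e x y → T (e ∧ not (e ∧ (x xor y))) → T x → T y
  step true true true _ _ = tt
  stays : ∀ {c d} → Star (λ c d → T (adjMinus Γ (∂ Γ s) c d)) c d → T (s c) → T (s d)
  stays ε                               sc = sc
  stays {c} (_◅_ {j = e} c→e walk) sc = stays walk (step (adj Γ c e) (s c) (s e) c→e sc)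

-- a disconnecting edge set contains the boundary of the component of x in Γ − F
component-boundary : ∀ Γ F → Disconnects Γ F →
  Σ (Fin (n Γ) → Bool) λ s → Proper s × (∀ a b → T (rem (∂ Γ s) a b) → T (rem F a b))
component-boundary Γ F (x , y , no-walk) =
  reach x , ((x , reach-centre x) , (y , no-walk ∘ reach-walk x)) , ∂⊆F
  where
  open Reachability (adjMinus Γ F)
  leaving⊆F : ∀ {a b} → T (reach x a) → ¬ T (reach x b) → T (adj Γ a b) → T (rem F a b)
  leaving⊆F {a} {b} ra ¬rb ab = decidable-stable (T? (rem F a b)) λ ¬F →
    ¬rb (reach-closed x ra (from T-∧ (ab , ¬T⇒T-not ¬F)))
  ∂⊆F : ∀ a b → T (rem (∂ Γ (reach x)) a b) → T (rem F a b)
  ∂⊆F a b cut with to T-∧ cut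
  ... | ab , separated with xor-cases (reach x a) (reach x b) separated
  ...   | inj₁ (ra , ¬rb) = leaving⊆F ra ¬rb ab
  ...   | inj₂ (¬ra , rb) = subst T (remSym F b a) (leaving⊆F rb ¬ra (subst T (Graph.sym Γ a b) ab))

rem-irrefl : ∀ {Γ} (F : EdgeSet Γ) x → rem F x x ≡ false
rem-irrefl {Γ} F x with rem F x x in Fxx
... | false = refl
... | true  = contradiction (trans (≡-sym (rem⊆ F x x Fxx)) (irrefl Γ x)) λ ()

arcs-size : ∀ Γ (F : EdgeSet Γ) → arcs (n Γ) (rem F) ≡ 2 * size F
arcs-size Γ F = arcs≡2*pairCount (n Γ) (rem F) (remSym F) (rem-irrefl F)

arcs-edges : ∀ Γ → arcs (n Γ) (adj Γ) ≡ 2 * e Γ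
arcs-edges Γ = arcs≡2*pairCount (n Γ) (adj Γ) (Graph.sym Γ) (irrefl Γ)

cross : (Γ : Graph) → (A B : Fin (n Γ) → Bool) → ℕ
cross Γ A B = ∑[ u < n Γ ] ∑[ v < n Γ ] b2n (adj Γ u v ∧ (A u xor B v))

cross-∂ : ∀ Γ s → cross Γ s s ≡ 2 * size (∂ Γ s)
cross-∂ Γ s = arcs-size Γ (∂ Γ s)

cross-sym : ∀ Γ A B → cross Γ A B ≡ cross Γ B A
cross-sym Γ A B = trans (∑-comm (λ u v → b2n (adj Γ u v ∧ (A u xor B v))))
  (sum-cong-≗ λ v → sum-cong-≗ λ u → cong b2n (cong₂ _∧_ (Graph.sym Γ u v) (xor-comm (A u) (B v))))

cross-cong : ∀ Γ {A A′ B B′} → (∀ u → A u ≡ A′ u) → (∀ v → B v ≡ B′ v) →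
             cross Γ A B ≡ cross Γ A′ B′
cross-cong Γ A≗A′ B≗B′ = sum-cong-≗ λ u → sum-cong-≗ λ v →
  cong (λ c → b2n (adj Γ u v ∧ c)) (cong₂ _xor_ (A≗A′ u) (B≗B′ v))

cross-compl : ∀ Γ A B → cross Γ (not ∘ A) (not ∘ B) ≡ cross Γ A B
cross-compl Γ A B = sum-cong-≗ λ u → sum-cong-≗ λ v → cong (λ c → b2n (adj Γ u v ∧ c)) (not-xor-not (A u) (B v))
  where
  not-xor-not : ∀ a b → not a xor not b ≡ a xor b
  not-xor-not true  b = refl
  not-xor-not false b = not-involutive b

cross-const : ∀ Γ a b → cross Γ (λ _ → a) (λ _ → b) ≡ b2n (a xor b) * arcs (n Γ) (adj Γ)
cross-const Γ a b = begin
  cross Γ (λ _ → a) (λ _ → b)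
    ≡⟨ sum-cong-≗ (λ u → sum-cong-≗ λ v → trans (b2n-∧ (adj Γ u v) (a xor b)) (*-comm (b2n (adj Γ u v)) c)) ⟩
  ∑[ u < n Γ ] ∑[ v < n Γ ] (c * b2n (adj Γ u v))
    ≡⟨ sum-cong-≗ (λ u → *-distribˡ-sum c (λ v → b2n (adj Γ u v))) ⟨
  ∑[ u < n Γ ] (c * ∑[ v < n Γ ] b2n (adj Γ u v))
    ≡⟨ *-distribˡ-sum c (λ u → ∑[ v < n Γ ] b2n (adj Γ u v)) ⟨
  c * arcs (n Γ) (adj Γ) ∎
  where
  open ≡-Reasoning
  c = b2n (a xor b)

cross-edgeless : ∀ Γ → (∀ a b → adj Γ a b ≡ false) → ∀ A B → cross Γ A B ≡ 0
cross-edgeless Γ no-edges A B = trans (sum-cong-≗ λ u → trans (sum-cong-≗ (no-term u)) (sum-replicate-zero (n Γ)))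
                                      (sum-replicate-zero (n Γ))
  where
  no-term : ∀ u v → b2n (adj Γ u v ∧ (A u xor B v)) ≡ 0
  no-term u v rewrite no-edges u v = refl

between : (Γ : Graph) → (Q P : Fin (n Γ) → Bool) → ℕ
between Γ Q P = ∑[ u < n Γ ] ∑[ v < n Γ ] b2n (Q u ∧ adj Γ u v ∧ P v)

between-rows : ∀ Γ Q P → between Γ Q P ≡ ∑[ u < n Γ ] (b2n (Q u) * ∑[ v < n Γ ] b2n (adj Γ u v ∧ P v))
between-rows Γ Q P = sum-cong-≗ λ u →
  trans (sum-cong-≗ (λ v → b2n-∧ (Q u) (adj Γ u v ∧ P v)))
        (≡-sym (*-distribˡ-sum (b2n (Q u)) (λ v → b2n (adj Γ u v ∧ P v))))

between-sym : ∀ Γ Q P → between Γ Q P ≡ between Γ P Q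
between-sym Γ Q P = trans (∑-comm (λ u v → b2n (Q u ∧ adj Γ u v ∧ P v)))
  (sum-cong-≗ λ v → sum-cong-≗ λ u → cong b2n (swap-ends (Q u) (P v) (Graph.sym Γ u v)))
  where
  swap-ends : ∀ q p {e e′} → e ≡ e′ → q ∧ e ∧ p ≡ p ∧ e′ ∧ q
  swap-ends true  true  refl = refl
  swap-ends true  false refl = ∧-zeroʳ _
  swap-ends false true  refl = ≡-sym (∧-zeroʳ _)
  swap-ends false false refl = refl

cross-split : ∀ Γ A B → cross Γ A B ≡ between Γ A (not ∘ B) + between Γ (not ∘ A) B
cross-split Γ A B =
  trans (sum-cong-≗ λ u → trans (sum-cong-≗ λ v → split (adj Γ u v) (A u) (B v))
                                (∑-distrib-+ (λ v → out u v) (λ v → into u v)))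
        (∑-distrib-+ (λ u → ∑[ v < n Γ ] out u v) (λ u → ∑[ v < n Γ ] into u v))
  where
  out into : Fin (n Γ) → Fin (n Γ) → ℕ
  out  u v = b2n (A u ∧ adj Γ u v ∧ not (B v))
  into u v = b2n (not (A u) ∧ adj Γ u v ∧ B v)
  split : ∀ e a b → b2n (e ∧ (a xor b)) ≡ b2n (a ∧ e ∧ not b) + b2n (not a ∧ e ∧ b)
  split false true  b     = refl
  split false false b     = refl
  split true  true  true  = refl
  split true  true  false = refl
  split true  false true  = refl
  split true  false false = refl

cross-singleton : ∀ Γ p → cross Γ (singleton p) (singleton p) ≡ 2 * deg Γ p
cross-singleton Γ p = begin
  cross Γ S S                    ≡⟨ cross-split Γ S S ⟩
  out + between Γ (not ∘ S) S    ≡⟨ cong (out +_) (between-sym Γ (not ∘ S) S) ⟩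
  out + out                      ≡⟨ cong (out +_) (+-identityʳ out) ⟨
  2 * out                        ≡⟨ cong (2 *_) out≡deg ⟩
  2 * deg Γ p                    ∎
  where
  open ≡-Reasoning
  S : Fin (n Γ) → Bool
  S = singleton p
  out : ℕ
  out = between Γ S (not ∘ S)
  avoid-p : ∀ v → b2n (adj Γ p v ∧ not (S v)) ≡ b2n (adj Γ p v)
  avoid-p v with v Fin.≟ p
  ... | yes refl = cong b2n (trans (∧-zeroʳ (adj Γ p p)) (≡-sym (irrefl Γ p)))
  ... | no _     = cong b2n (∧-identityʳ (adj Γ p v))
  out≡deg : out ≡ deg Γ p
  out≡deg = begin
    out                                                                   ≡⟨ between-rows Γ S (not ∘ S) ⟩
    ∑[ u < n Γ ] (b2n (S u) * ∑[ v < n Γ ] b2n (adj Γ u v ∧ not (S v)))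
      ≡⟨ ∑-indicator p (λ u → ∑[ v < n Γ ] b2n (adj Γ u v ∧ not (S v))) ⟩
    ∑[ v < n Γ ] b2n (adj Γ p v ∧ not (S v))                              ≡⟨ sum-cong-≗ avoid-p ⟩
    ∑[ v < n Γ ] b2n (adj Γ p v)                                          ≡⟨ deg≡∑ Γ p ⟨
    deg Γ p                                                               ∎

BoundaryOfSize : Graph → ℕ → Set
BoundaryOfSize Γ v = Σ (Fin (n Γ) → Bool) λ s → Proper s × size (∂ Γ s) ≡ v

BoundariesAtLeast : Graph → ℕ → Set
BoundariesAtLeast Γ v = ∀ s → Proper s → v ≤ size (∂ Γ s)

smaller-boundary : ∀ Γ {a b} → BoundaryOfSize Γ a → BoundaryOfSize Γ b → BoundaryOfSize Γ (a ⊓ b)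
smaller-boundary Γ {a} {b} A B with ⊓-sel a b
... | inj₁ a⊓b≡a = subst (BoundaryOfSize Γ) (≡-sym a⊓b≡a) A
... | inj₂ a⊓b≡b = subst (BoundaryOfSize Γ) (≡-sym a⊓b≡b) B

edgeConn-from-boundaries : ∀ Γ v → 2 ≤ n Γ → BoundaryOfSize Γ v → BoundariesAtLeast Γ v → IsEdgeConn Γ v
edgeConn-from-boundaries Γ v 2≤n (s , proper , |∂s|≡v) lower =
  inj₂ (2≤n , (∂ Γ s , ∂-disconnects Γ s proper , |∂s|≡v) , every-cut)
  where
  every-cut : ∀ F → Disconnects Γ F → v ≤ size F
  every-cut F disc with component-boundary Γ F disc
  ... | t , t-proper , ∂t⊆F = ≤-trans (lower t t-proper) (pairCount-mono (n Γ) (rem (∂ Γ t)) (rem F) ∂t⊆F)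

boundaries-of-edgeConn : ∀ Γ k (F : EdgeSet Γ) → Disconnects Γ F → size F ≡ k →
  (∀ F′ → Disconnects Γ F′ → k ≤ size F′) → BoundaryOfSize Γ k × BoundariesAtLeast Γ k
boundaries-of-edgeConn Γ k F disc |F|≡k minimal with component-boundary Γ F disc
... | s , proper , ∂s⊆F =
  (s , proper , ≤-antisym (≤-trans (pairCount-mono (n Γ) (rem (∂ Γ s)) (rem F) ∂s⊆F) (≤-reflexive |F|≡k))
                          (at-least s proper)) ,
  at-least
  where
  at-least : BoundariesAtLeast Γ k
  at-least s proper = minimal (∂ Γ s) (∂-disconnects Γ s proper)

edgeless-edgeConn : ∀ Γ → (∀ a b → adj Γ a b ≡ false) → IsEdgeConn Γ 0
edgeless-edgeConn Γ no-edges with n Γ ≤? 1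
... | yes n≤1 = inj₁ (n≤1 , refl)
... | no  n≰1 = edgeConn-from-boundaries Γ 0 2≤n (singleton p , singleton-proper 2≤n p , empty-boundary) (λ _ _ → z≤n)
  where
  2≤n : 2 ≤ n Γ
  2≤n = ≰⇒> n≰1
  p : Fin (n Γ)
  p = Fin.fromℕ< (<⇒≤ 2≤n)
  empty-boundary : size (∂ Γ (singleton p)) ≡ 0
  empty-boundary = *-cancelˡ-≡ _ 0 2 (trans (≡-sym (cross-∂ Γ (singleton p)))
                                            (cross-edgeless Γ no-edges (singleton p) (singleton p)))

-- If |V(H)| < 2δ(H), every proper A ⊆ V(H) is crossed by at
-- least δ(H) edges against any B: each vertex of A has at least δ − |B|
-- neighbours outside B, each vertex of B at least δ − |A| neighbours outside
-- A, and after complementing both sets if necessary, |A| + |B| < 2δ.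

neighbours-outside : ∀ Γ u (P : Fin (n Γ) → Bool) →
                     δ Γ ∸ count P ≤ ∑[ v < n Γ ] b2n (adj Γ u v ∧ not (P v))
neighbours-outside Γ u P = m≤n+o⇒m∸n≤o (δ Γ) (count P) (begin
  δ Γ                                                     ≤⟨ δ≤deg Γ u ⟩
  deg Γ u                                                 ≡⟨ deg≡∑ Γ u ⟩
  ∑[ v < n Γ ] b2n (adj Γ u v)
    ≤⟨ ∑-mono-≤ (λ v → inside-or-outside (adj Γ u v) (P v)) ⟩
  ∑[ v < n Γ ] (b2n (P v) + b2n (adj Γ u v ∧ not (P v)))
    ≡⟨ ∑-distrib-+ (b2n ∘ P) (λ v → b2n (adj Γ u v ∧ not (P v))) ⟩
  count P + ∑[ v < n Γ ] b2n (adj Γ u v ∧ not (P v))      ∎)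
  where
  open ≤-Reasoning
  inside-or-outside : ∀ e p → b2n e ≤ b2n p + b2n (e ∧ not p)
  inside-or-outside true  true  = s≤s z≤n
  inside-or-outside true  false = ≤-refl
  inside-or-outside false p     = z≤n

between-lower : ∀ Γ Q P → count Q * (δ Γ ∸ count P) ≤ between Γ Q (not ∘ P)
between-lower Γ Q P = begin
  count Q * (δ Γ ∸ count P)
    ≡⟨ *-distribʳ-sum (δ Γ ∸ count P) (b2n ∘ Q) ⟩
  ∑[ u < n Γ ] (b2n (Q u) * (δ Γ ∸ count P))
    ≤⟨ ∑-mono-≤ (λ u → *-monoʳ-≤ (b2n (Q u)) (neighbours-outside Γ u P)) ⟩
  ∑[ u < n Γ ] (b2n (Q u) * ∑[ v < n Γ ] b2n (adj Γ u v ∧ not (P v)))  ≡⟨ between-rows Γ Q (not ∘ P) ⟨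
  between Γ Q (not ∘ P)                                                 ∎
  where open ≤-Reasoning

scaled : ∀ m {k} → 1 ≤ k → m ≤ m * k
scaled m 1≤k = ≤-trans (≤-reflexive (≡-sym (*-identityʳ m))) (*-monoʳ-≤ m 1≤k)

balance : ∀ p q d → 1 ≤ p → p + q < 2 * d → d ≤ p * (d ∸ q) + q * (d ∸ p)
balance p q d 1≤p p+q<2d with d ≤? p | d ≤? q
... | yes d≤p | _ = ≤-trans d≤p (≤-trans (scaled p (m<n⇒0<n∸m q<d)) (m≤m+n _ _))
  where
  q<d : q < d
  q<d = +-cancelˡ-< d q d (≤-<-trans (+-monoˡ-≤ q d≤p) (subst (p + q <_) (cong (d +_) (+-identityʳ d)) p+q<2d))
... | no d≰p | yes d≤q = ≤-trans d≤q (≤-trans (scaled q (m<n⇒0<n∸m (≰⇒> d≰p))) (m≤n+m _ _))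
... | no d≰p | no d≰q with q
...   | zero   = ≤-trans (≤-trans (≤-reflexive (≡-sym (*-identityˡ d))) (*-monoˡ-≤ d 1≤p)) (m≤m+n _ _)
...   | suc q′ = begin
  d                                   ≡⟨ m+[n∸m]≡n (<⇒≤ (≰⇒> d≰p)) ⟨
  p + (d ∸ p)                         ≤⟨ +-mono-≤ (scaled p (m<n⇒0<n∸m (≰⇒> d≰q))) (m≤m+n (d ∸ p) _) ⟩
  p * (d ∸ suc q′) + suc q′ * (d ∸ p) ∎
  where open ≤-Reasoning

cross-lower-balanced : ∀ H A B → 1 ≤ count A → count A + count B < 2 * δ H → δ H ≤ cross H A B
cross-lower-balanced H A B 1≤|A| balanced = begin
  δ H                                                    ≤⟨ balance (count A) (count B) (δ H) 1≤|A| balanced ⟩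
  count A * (δ H ∸ count B) + count B * (δ H ∸ count A)  ≤⟨ +-mono-≤ (between-lower H A B) (between-lower H B A) ⟩
  between H A (not ∘ B) + between H B (not ∘ A)
    ≡⟨ cong (between H A (not ∘ B) +_) (between-sym H B (not ∘ A)) ⟩
  between H A (not ∘ B) + between H (not ∘ A) B          ≡⟨ cross-split H A B ⟨
  cross H A B                                            ∎
  where open ≤-Reasoning

mixed-cross-lower : ∀ H → n H < 2 * δ H → ∀ A B → Proper A → δ H ≤ cross H A B
mixed-cross-lower H dense A B ((a , Aa) , (a′ , ¬Aa′)) with count A + count B <? 2 * δ H
... | yes balanced  = cross-lower-balanced H A B (count-pos A a Aa) balanced
... | no unbalanced = subst (δ H ≤_) (cross-compl H A B)
  (cross-lower-balanced H (not ∘ A) (not ∘ B) (count-pos (not ∘ A) a′ (¬T⇒T-not ¬Aa′)) complements-balanced)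
  where
  |A| = count A
  |B| = count B
  |Ā| = count (not ∘ A)
  |B̄| = count (not ∘ B)
  complements-balanced : |Ā| + |B̄| < 2 * δ H
  complements-balanced = +-cancelˡ-< (|A| + |B|) (|Ā| + |B̄|) (2 * δ H) (begin-strict
    (|A| + |B|) + (|Ā| + |B̄|)  ≡⟨ interchange |A| |B| |Ā| |B̄| ⟩
    (|A| + |Ā|) + (|B| + |B̄|)  ≡⟨ cong₂ _+_ (count-compl A) (count-compl B) ⟩
    n H + n H                  <⟨ +-mono-< dense dense ⟩
    2 * δ H + 2 * δ H          ≤⟨ +-monoˡ-≤ (2 * δ H) (≮⇒≥ unbalanced) ⟩
    (|A| + |B|) + 2 * δ H      ∎)
    where open ≤-Reasoning

Fin≤1-unique : ∀ {m} → m ≤ 1 → (a b : Fin m) → a ≡ b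
Fin≤1-unique (s≤s z≤n) zero zero = refl

twice-twice : ∀ k e → (2 * k) * (2 * e) ≡ 2 * (2 * k * e)
twice-twice = solve-∀

module Product (G H : Graph) where

  P : Graph
  P = G ×ᵍ H

  adj-combine : ∀ x u y v → adj P (combine x u) (combine y v) ≡ adj G x y ∧ adj H u v
  adj-combine x u y v = cong₂ (λ p q → adj G (proj₁ p) (proj₁ q) ∧ adj H (proj₂ p) (proj₂ q))
                              (remQuot-combine {n G} {n H} x u) (remQuot-combine {n G} {n H} y v)

  fibre : (Fin (n P) → Bool) → Fin (n G) → Fin (n H) → Bool
  fibre s x u = s (combine x u)

  ∑∑-combine : (f : Fin (n G * n H) → Fin (n G * n H) → ℕ) →
    ∑[ i < n G * n H ] ∑[ j < n G * n H ] f i j ≡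
    ∑[ x < n G ] ∑[ y < n G ] ∑[ u < n H ] ∑[ v < n H ] f (combine x u) (combine y v)
  ∑∑-combine f = begin
    ∑[ i < n G * n H ] ∑[ j < n G * n H ] f i j
      ≡⟨ ∑-combine (n G) (n H) (λ i → ∑[ j < n G * n H ] f i j) ⟩
    ∑[ x < n G ] ∑[ u < n H ] ∑[ j < n G * n H ] f (combine x u) j
      ≡⟨ sum-cong-≗ (λ (x : Fin (n G)) → sum-cong-≗ λ (u : Fin (n H)) → row-split (combine x u)) ⟩
    ∑[ x < n G ] ∑[ u < n H ] ∑[ y < n G ] ∑[ v < n H ] f (combine x u) (combine y v)
      ≡⟨ sum-cong-≗ (λ (x : Fin (n G)) →
           ∑-comm (λ (u : Fin (n H)) (y : Fin (n G)) → ∑[ v < n H ] f (combine x u) (combine y v))) ⟩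
    ∑[ x < n G ] ∑[ y < n G ] ∑[ u < n H ] ∑[ v < n H ] f (combine x u) (combine y v) ∎
    where
    open ≡-Reasoning
    row-split : ∀ i → ∑[ j < n G * n H ] f i j ≡ ∑[ y < n G ] ∑[ v < n H ] f i (combine y v)
    row-split i = ∑-combine (n G) (n H) (f i)

  cross-product : ∀ s t → cross P s t ≡
    ∑[ x < n G ] ∑[ y < n G ] (b2n (adj G x y) * cross H (fibre s x) (fibre t y))
  cross-product s t =
    trans (∑∑-combine (λ i j → b2n (adj P i j ∧ (s i xor t j)))) (sum-cong-≗ λ x → sum-cong-≗ λ y →
    let c = b2n (adj G x y)
        h : Fin (n H) → Fin (n H) → ℕ
        h u v = b2n (adj H u v ∧ (fibre s x u xor fibre t y v))
    in begin
      ∑[ u < n H ] ∑[ v < n H ] b2n (adj P (combine x u) (combine y v) ∧ (fibre s x u xor fibre t y v))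
        ≡⟨ sum-cong-≗ (λ u → sum-cong-≗ λ v → factor x y u v) ⟩
      ∑[ u < n H ] ∑[ v < n H ] (c * h u v)  ≡⟨ sum-cong-≗ (λ u → *-distribˡ-sum c (h u)) ⟨
      ∑[ u < n H ] (c * ∑[ v < n H ] h u v)  ≡⟨ *-distribˡ-sum c (λ u → ∑[ v < n H ] h u v) ⟨
      c * cross H (fibre s x) (fibre t y)    ∎)
    where
    open ≡-Reasoning
    factor : ∀ x y u v → b2n (adj P (combine x u) (combine y v) ∧ (fibre s x u xor fibre t y v)) ≡
                          b2n (adj G x y) * b2n (adj H u v ∧ (fibre s x u xor fibre t y v))
    factor x y u v rewrite adj-combine x u y v =
      trans (cong b2n (∧-assoc (adj G x y) (adj H u v) _)) (b2n-∧ (adj G x y) _)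

  deg-product : ∀ x u → deg P (combine x u) ≡ deg G x * deg H u
  deg-product x u = begin
    deg P (combine x u)                              ≡⟨ deg≡∑ P (combine x u) ⟩
    ∑[ j < n G * n H ] b2n (adj P (combine x u) j)   ≡⟨ ∑-combine (n G) (n H) (λ j → b2n (adj P (combine x u) j)) ⟩
    ∑[ y < n G ] ∑[ v < n H ] b2n (adj P (combine x u) (combine y v))
      ≡⟨ sum-cong-≗ (λ y → sum-cong-≗ λ v → trans (cong b2n (adj-combine x u y v)) (b2n-∧ (adj G x y) (adj H u v))) ⟩
    ∑[ y < n G ] ∑[ v < n H ] (b2n (adj G x y) * b2n (adj H u v))
      ≡⟨ sum-cong-≗ (λ y → *-distribˡ-sum (b2n (adj G x y)) (λ v → b2n (adj H u v))) ⟨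
    ∑[ y < n G ] (b2n (adj G x y) * ∑[ v < n H ] b2n (adj H u v))
      ≡⟨ *-distribʳ-sum (∑[ v < n H ] b2n (adj H u v)) (λ y → b2n (adj G x y)) ⟨
    ∑[ y < n G ] b2n (adj G x y) * ∑[ v < n H ] b2n (adj H u v)  ≡⟨ cong₂ _*_ (deg≡∑ G x) (deg≡∑ H u) ⟨
    deg G x * deg H u                                ∎
    where open ≡-Reasoning

  cross-cylinder : ∀ s (X : Fin (n G) → Bool) → (∀ x u → fibre s x u ≡ X x) →
                   cross P s s ≡ cross G X X * arcs (n H) (adj H)
  cross-cylinder s X fibre≡X = begin
    cross P s s                                                          ≡⟨ cross-product s s ⟩
    ∑[ x < n G ] ∑[ y < n G ] (b2n (adj G x y) * cross H (fibre s x) (fibre s y))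
      ≡⟨ sum-cong-≗ (λ x → sum-cong-≗ λ y → cong (b2n (adj G x y) *_) (constant-fibres x y)) ⟩
    ∑[ x < n G ] ∑[ y < n G ] (b2n (adj G x y) * (b2n (X x xor X y) * a))
      ≡⟨ sum-cong-≗ (λ x → sum-cong-≗ λ y → regroup x y) ⟩
    ∑[ x < n G ] ∑[ y < n G ] (b2n (adj G x y ∧ (X x xor X y)) * a)
      ≡⟨ sum-cong-≗ (λ x → *-distribʳ-sum a (λ y → b2n (adj G x y ∧ (X x xor X y)))) ⟨
    ∑[ x < n G ] (∑[ y < n G ] b2n (adj G x y ∧ (X x xor X y)) * a)
      ≡⟨ *-distribʳ-sum a (λ x → ∑[ y < n G ] b2n (adj G x y ∧ (X x xor X y))) ⟨
    cross G X X * a                                                      ∎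
    where
    open ≡-Reasoning
    a = arcs (n H) (adj H)
    constant-fibres : ∀ x y → cross H (fibre s x) (fibre s y) ≡ b2n (X x xor X y) * a
    constant-fibres x y = trans (cross-cong H (fibre≡X x) (fibre≡X y)) (cross-const H (X x) (X y))
    regroup : ∀ x y → b2n (adj G x y) * (b2n (X x xor X y) * a) ≡ b2n (adj G x y ∧ (X x xor X y)) * a
    regroup x y = trans (≡-sym (*-assoc (b2n (adj G x y)) _ a)) (cong (_* a) (≡-sym (b2n-∧ (adj G x y) _)))

  -- a proper fibre over x: row and column of x each contribute deg x · δ(H)
  cross-mixed-fibre : n H < 2 * δ H → ∀ s x → Proper (fibre s x) → 2 * (δ G * δ H) ≤ cross P s s
  cross-mixed-fibre dense s x mixed = begin
    2 * (δ G * δ H)                            ≡⟨ cong (δ G * δ H +_) (+-identityʳ (δ G * δ H)) ⟩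
    δ G * δ H + δ G * δ H                      ≤⟨ +-mono-≤ δGδH≤ δGδH≤ ⟩
    deg G x * δ H + deg G x * δ H              ≤⟨ +-mono-≤ row-bound column-bound ⟩
    ∑[ z < n G ] g x z + ∑[ y < n G ] g y x    ≤⟨ row+column≤∑∑ g x gxx≡0 ⟩
    ∑[ y < n G ] ∑[ z < n G ] g y z            ≡⟨ cross-product s s ⟨
    cross P s s                                ∎
    where
    open ≤-Reasoning
    g : Fin (n G) → Fin (n G) → ℕ
    g y z = b2n (adj G y z) * cross H (fibre s y) (fibre s z)
    gxx≡0 : g x x ≡ 0
    gxx≡0 rewrite irrefl G x = refl
    δGδH≤ : δ G * δ H ≤ deg G x * δ H
    δGδH≤ = *-monoˡ-≤ (δ H) (δ≤deg G x)
    deg×δ : deg G x * δ H ≡ ∑[ z < n G ] (b2n (adj G x z) * δ H)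
    deg×δ = trans (cong (_* δ H) (deg≡∑ G x)) (*-distribʳ-sum (δ H) (λ z → b2n (adj G x z)))
    row-bound : deg G x * δ H ≤ ∑[ z < n G ] g x z
    row-bound = ≤-trans (≤-reflexive deg×δ) (∑-mono-≤ λ z →
      *-monoʳ-≤ (b2n (adj G x z)) (mixed-cross-lower H dense (fibre s x) (fibre s z) mixed))
    column-bound : deg G x * δ H ≤ ∑[ y < n G ] g y x
    column-bound = ≤-trans (≤-reflexive deg×δ) (∑-mono-≤ λ y →
      *-mono-≤ (≤-reflexive (cong b2n (Graph.sym G x y)))
               (≤-trans (mixed-cross-lower H dense (fibre s x) (fibre s y) mixed)
                        (≤-reflexive (cross-sym H (fibre s x) (fibre s y)))))

  some-fibre-mixed : ∀ s u₀ → Σ (Fin (n G)) (λ x → Proper (fibre s x)) ⊎ (∀ x u → fibre s x u ≡ fibre s x u₀)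
  some-fibre-mixed s u₀ with any? (λ x → any? (λ u → ¬? (fibre s x u Bool.≟ fibre s x u₀)))
  ... | yes (x , u , differ) = inj₁ (x , values-differ (fibre s x) u u₀ differ)
  ... | no none = inj₂ λ x u → decidable-stable (fibre s x u Bool.≟ fibre s x u₀) (λ differ → none (x , u , differ))

  constant-fibres-proper : ∀ s u₀ → (∀ x u → fibre s x u ≡ fibre s x u₀) → Proper s →
                           Proper (λ x → fibre s x u₀)
  constant-fibres-proper s u₀ constant ((a , sa) , (b , ¬sb)) =
    (proj₁ (pr G H a) , subst T (base a) sa) , (proj₁ (pr G H b) , ¬sb ∘ subst T (≡-sym (base b)))
    where
    base : ∀ i → s i ≡ fibre s (proj₁ (pr G H i)) u₀
    base i = trans (cong s (≡-sym (combine-remQuot {n G} (n H) i))) (constant _ _)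

  boundary-lower : n H < 2 * δ H → Fin (n H) → ∀ k → BoundariesAtLeast G k →
                   BoundariesAtLeast P ((2 * k * e H) ⊓ (δ G * δ H))
  boundary-lower dense u₀ k at-least s proper =
    *-cancelˡ-≤ 2 (≤-trans twice-bound (≤-reflexive (cross-∂ P s)))
    where
    open ≤-Reasoning
    twice-bound : 2 * ((2 * k * e H) ⊓ (δ G * δ H)) ≤ cross P s s
    twice-bound with some-fibre-mixed s u₀
    ... | inj₁ (x , mixed) =
      ≤-trans (*-monoʳ-≤ 2 (m⊓n≤n (2 * k * e H) (δ G * δ H))) (cross-mixed-fibre dense s x mixed)
    ... | inj₂ constant = ≤-trans (*-monoʳ-≤ 2 (m⊓n≤m (2 * k * e H) (δ G * δ H))) (begin
      2 * (2 * k * e H)                        ≡⟨ twice-twice k (e H) ⟨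
      (2 * k) * (2 * e H)
        ≤⟨ *-mono-≤ (*-monoʳ-≤ 2 (at-least X X-proper)) (≤-reflexive (≡-sym (arcs-edges H))) ⟩
      (2 * size (∂ G X)) * arcs (n H) (adj H)  ≡⟨ cong (_* arcs (n H) (adj H)) (cross-∂ G X) ⟨
      cross G X X * arcs (n H) (adj H)         ≡⟨ cross-cylinder s X constant ⟨
      cross P s s                              ∎)
      where
      X : Fin (n G) → Bool
      X x = fibre s x u₀
      X-proper : Proper X
      X-proper = constant-fibres-proper s u₀ constant proper

  cylinder : (Fin (n G) → Bool) → Fin (n P) → Bool
  cylinder X i = X (proj₁ (pr G H i))

  fibre-cylinder : ∀ X x u → fibre (cylinder X) x u ≡ X x
  fibre-cylinder X x u = cong (X ∘ proj₁) (remQuot-combine {n G} {n H} x u)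

  cylinder-boundary : Fin (n H) → ∀ {k} → BoundaryOfSize G k → BoundaryOfSize P (2 * k * e H)
  cylinder-boundary u₀ {k} (X , ((a , Xa) , (b , ¬Xb)) , |∂X|≡k) =
    cylinder X ,
    ((combine a u₀ , subst T (≡-sym (fibre-cylinder X a u₀)) Xa) ,
     (combine b u₀ , ¬Xb ∘ subst T (fibre-cylinder X b u₀))) ,
    *-cancelˡ-≡ _ _ 2 (begin
      2 * size (∂ P (cylinder X))        ≡⟨ cross-∂ P (cylinder X) ⟨
      cross P (cylinder X) (cylinder X)  ≡⟨ cross-cylinder (cylinder X) X (fibre-cylinder X) ⟩
      cross G X X * arcs (n H) (adj H)   ≡⟨ cong₂ _*_ (trans (cross-∂ G X) (cong (2 *_) |∂X|≡k)) (arcs-edges H) ⟩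
      (2 * k) * (2 * e H)                ≡⟨ twice-twice k (e H) ⟩
      2 * (2 * k * e H)                  ∎)
    where open ≡-Reasoning

  star-boundary : 2 ≤ n P → ∀ x u → BoundaryOfSize P (deg G x * deg H u)
  star-boundary 2≤N x u = singleton p , singleton-proper 2≤N p , *-cancelˡ-≡ _ _ 2 (begin
    2 * size (∂ P (singleton p))         ≡⟨ cross-∂ P (singleton p) ⟨
    cross P (singleton p) (singleton p)  ≡⟨ cross-singleton P p ⟩
    2 * deg P p                          ≡⟨ cong (2 *_) (deg-product x u) ⟩
    2 * (deg G x * deg H u)              ∎)
    where
    open ≡-Reasoning
    p = combine x u

  trivial-factor-edgeless : n G ≤ 1 → ∀ i j → adj P i j ≡ false
  trivial-factor-edgeless n≤1 i j
    rewrite Fin≤1-unique n≤1 (proj₁ (pr G H j)) (proj₁ (pr G H i)) | irrefl G (proj₁ (pr G H i)) = refl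

-- A factor G with at most one vertex makes G × H edgeless;
-- otherwise the cylinder over a minimum boundary of G and the star of a pair
-- of minimum-degree vertices meet the lower bound of boundary-lower.
theorem1 : (G H : Graph) → n H < 2 * δ H →
    (k : ℕ) → IsEdgeConn G k →
    IsEdgeConn (G ×ᵍ H) ((2 * k * e H) ⊓ (δ G * δ H))
theorem1 G H dense k (inj₁ (n≤1 , refl)) =
  edgeless-edgeConn (G ×ᵍ H) (Product.trivial-factor-edgeless G H n≤1)
theorem1 G H dense k (inj₂ (2≤n , (F , disc , |F|≡k) , minimal))
  with boundaries-of-edgeConn G k F disc |F|≡k minimal
     | δ-attained G (<⇒≤ 2≤n)
     | δ-attained H (dense-nonempty H dense)
... | G-boundary , G-at-least | x₀ , deg-x₀ | u₀ , deg-u₀ =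
  edgeConn-from-boundaries P _ 2≤N
    (smaller-boundary P (cylinder-boundary u₀ G-boundary) star)
    (boundary-lower dense u₀ k G-at-least)
  where
  open Product G H
  2≤N : 2 ≤ n G * n H
  2≤N = *-mono-≤ 2≤n (dense-nonempty H dense)
  star : BoundaryOfSize P (δ G * δ H)
  star = subst (BoundaryOfSize P) (cong₂ _*_ deg-x₀ deg-u₀) (star-boundary 2≤N x₀ u₀)
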